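{- Let $F=F^+\wedge F^-$ be an $(\ell,k)$-CNF formula. If there is $\rho\in(0,1)$ such that $|F^+|<\frac12(1-\rho)^{ -\ell}$ and $|F^-|<\frac12\rho^{ -k}$, then $F$ is satisfiable.
   Context: A literal is a boolean variable $x$ or its negation $\bar{x}$. A clause is a finite set of literals containing no variable together with its negation; a CNF formula is a finite set of clauses (their conjunction); $|F|$ is its number of clauses. An $(\ell,k)$-CNF formula is a CNF formula consisting of $\ell$-clauses containing only positive literals and $k$-clauses containing only negative literals; one writes $F=F^+\wedge F^-$ where $F^+$ is the set of positive $\ell$-clauses and $F^-$ the set of negative $k$-clauses.
   Formalization: The number $\rho\in(0,1)$ in the hypothesis is required to be rational. -}

module Defs where

open import Data.Nat using (ℕ; zero; suc)
open import Data.Bool using (Bool; true; false)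
open import Data.List using (List; length)
open import Data.List.Relation.Unary.All using (All)
open import Data.List.Relation.Unary.Any using (Any)
open import Data.List.Relation.Unary.Unique.Propositional using (Unique)
open import Data.Product using (Σ; _×_)
open import Data.Integer using (+_)
open import Data.Rational using (ℚ; _/_; 1ℚ; _*_)
open import Relation.Binary.PropositionalEquality using (_≡_)

data Literal : Set where
  pos : ℕ → Literal
  neg : ℕ → Literal

Assignment : Set
Assignment = ℕ → Bool

evalLit : Assignment → Literal → Bool
evalLit α (pos x) = α x
evalLit α (neg x) with α x
... | true  = false
... | false = true

-- A clause is a finite set of literals, represented as a duplicate-free list.
Clause : Set
Clause = List Literal

-- A CNF formula is a finite set of clauses, represented as a duplicate-free list.
CNF : Set
CNF = List Clause

∣_∣ : CNF → ℕ
∣ F ∣ = length F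

SatisfiesClause : Assignment → Clause → Set
SatisfiesClause α C = Any (λ l → evalLit α l ≡ true) C

Satisfiable : CNF → Set
Satisfiable F = Σ Assignment (λ α → All (SatisfiesClause α) F)

data IsPos : Literal → Set where
  isPos : ∀ x → IsPos (pos x)

data IsNeg : Literal → Set where
  isNeg : ∀ x → IsNeg (neg x)

PositiveClause : ℕ → Clause → Set
PositiveClause ℓ C = Unique C × length C ≡ ℓ × All IsPos C

NegativeClause : ℕ → Clause → Set
NegativeClause k C = Unique C × length C ≡ k × All IsNeg C

IsPositivePart : ℕ → CNF → Set
IsPositivePart ℓ F = Unique F × All (PositiveClause ℓ) F

IsNegativePart : ℕ → CNF → Set
IsNegativePart k F = Unique F × All (NegativeClause k) F

ℕtoℚ : ℕ → ℚ
ℕtoℚ n = + n / 1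

_^ℚ_ : ℚ → ℕ → ℚ
q ^ℚ zero  = 1ℚ
q ^ℚ suc n = q * (q ^ℚ n)

-- Set each variable true independently with probability ρ. A positive ℓ-clause is then
-- falsified with probability (1-ρ)^ℓ and a negative k-clause with probability ρ^k, so the
-- expected number of falsified clauses (the weight of F) is below 1/2 + 1/2. Fixing a
-- variable to true or false yields two restricted formulas whose weights, averaged with
-- probabilities ρ and 1-ρ, are at most the weight of F (as no clause repeats a literal), so
-- one of them still has weight below 1. Repeating this until no literal is left (the method
-- of conditional expectations) yields a satisfying assignment, because an empty clause
-- alone has weight 1.
module Submission where

open import Defs
open import Data.List using (_++_)
open import Data.Rational using (ℚ; 0ℚ; 1ℚ; _<_; _*_; _-_)
open import Data.Nat using (ℕ)
open import Data.Product using (Σ; _×_)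

open import Data.Bool using (Bool; true; false)
open import Data.Empty using (⊥-elim)
import Data.Integer as ℤ
import Data.Integer.Properties as ℤ
open import Data.List using (List; []; _∷_; length; map; mapMaybe)
open import Data.Nat.ListAction using (sum)
open import Data.List.Relation.Unary.All as All using (All; []; _∷_)
import Data.List.Relation.Unary.All.Properties as All
open import Data.List.Relation.Unary.Any using (here; there)
open import Data.List.Relation.Unary.AllPairs using ([]; _∷_)
open import Data.List.Relation.Unary.Unique.Propositional using (Unique)
open import Data.List.Relation.Binary.Sublist.Propositional using (_⊆_; []; _∷_; _∷ʳ_)
open import Data.List.Relation.Binary.Sublist.Propositional.Properties
  using (All-resp-⊆; length-mono-≤)
open import Data.Maybe using (Maybe; just; nothing; maybe)
open import Data.Maybe.Relation.Unary.All using (just; nothing)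
import Data.Maybe.Relation.Unary.All as Maybe
open import Data.Nat as ℕ using (zero; suc; z≤n; s≤s; _≟_)
import Data.Nat.Properties as ℕ
import Data.Nat.Coprimality as Coprime
open import Data.Product using (_,_; proj₁)
open import Data.Rational using (_≤_; _+_; -_; _/_; mkℚ; nonNegative; _<?_)
open import Data.Rational.Properties
  using ( module ≤-Reasoning; ≤-refl; ≤-trans; ≤-reflexive; ≤-<-trans; <⇒≤; <-irrefl; ≮⇒≥
        ; +-assoc; +-identityˡ; +-identityʳ; +-inverseʳ; *-identityˡ; *-zeroˡ; *-zeroʳ; *-distribʳ-+
        ; +-mono-≤; +-monoˡ-≤; +-monoʳ-≤; +-mono-<; *-monoˡ-≤-nonNeg; normalize-coprime )
open import Data.Rational.Solver using (module +-*-Solver)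
open import Data.Sum using (_⊎_; inj₁; inj₂; [_,_]′)
open import Relation.Nullary using (yes; no)
open import Relation.Binary.PropositionalEquality

open +-*-Solver using (solve; _:+_; _:*_; _:-_; _:=_; con)
open ≤-Reasoning

var : Literal → ℕ
var (pos x) = x
var (neg x) = x

evalLit-local : ∀ {α β} l → α (var l) ≡ β (var l) → evalLit α l ≡ evalLit β l
evalLit-local (pos x) eq = eq
evalLit-local (neg x) eq rewrite eq = refl

_[_≔_] : Assignment → ℕ → Bool → Assignment
(α [ x ≔ b ]) y with y ≟ x
... | yes _ = b
... | no  _ = α y

[≔]-same : ∀ {α x b y} → y ≡ x → (α [ x ≔ b ]) y ≡ b
[≔]-same {x = x} {y = y} y≡x with y ≟ x
... | yes _   = refl
... | no  y≢x = ⊥-elim (y≢x y≡x)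

[≔]-other : ∀ {α x b y} → y ≢ x → (α [ x ≔ b ]) y ≡ α y
[≔]-other {x = x} {y = y} y≢x with y ≟ x
... | yes y≡x = ⊥-elim (y≢x y≡x)
... | no  _   = refl

falsifiedBy : ℕ → Bool → Literal
falsifiedBy x true  = neg x
falsifiedBy x false = pos x

falsified-literal : ∀ {x b} l → var l ≡ x → evalLit (λ _ → b) l ≡ false → l ≡ falsifiedBy x b
falsified-literal {b = true}  (pos _) _    ()
falsified-literal {b = false} (pos _) refl refl = refl
falsified-literal {b = true}  (neg _) refl refl = refl
falsified-literal {b = false} (neg _) _    ()

-- The clause under x := b: nothing if it becomes satisfied, otherwise the clause with
-- its (falsified) literals on x removed.
restrictClause : ℕ → Bool → Clause → Maybe Clause
restrictClause x b [] = just []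
restrictClause x b (l ∷ C) with var l ≟ x | evalLit (λ _ → b) l
... | no  _ | _     = Data.Maybe.map (l ∷_) (restrictClause x b C)
... | yes _ | true  = nothing
... | yes _ | false = restrictClause x b C

restrict : ℕ → Bool → CNF → CNF
restrict x b = mapMaybe (restrictClause x b)

restrictClause-sound : ∀ {α x b} C → Maybe.All (SatisfiesClause α) (restrictClause x b C) →
                       SatisfiesClause (α [ x ≔ b ]) C
restrictClause-sound [] (just ())
restrictClause-sound {α} {x} {b} (l ∷ C) s with var l ≟ x | evalLit (λ _ → b) l in value
... | yes l∈x | true  = here (trans (evalLit-local l ([≔]-same l∈x)) value)
... | yes _   | false = there (restrictClause-sound C s)
... | no  l∉x | _ with restrictClause x b C | restrictClause-sound {α} {x} {b} C
...   | nothing | sound = there (sound nothing)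
...   | just _  | sound with s
...     | just (here p)  = here (trans (evalLit-local l ([≔]-other l∉x)) p)
...     | just (there q) = there (sound (just q))

restrict-sound : ∀ {α x b} F → All (SatisfiesClause α) (restrict x b F) →
                 All (SatisfiesClause (α [ x ≔ b ])) F
restrict-sound [] _ = []
restrict-sound {α} {x} {b} (C ∷ F) s with restrictClause x b C | restrictClause-sound {α} {x} {b} C
... | nothing | sound = sound nothing ∷ restrict-sound F s
... | just _  | sound with s
...   | p ∷ ps = sound (just p) ∷ restrict-sound F ps

restrictClause-⊆ : ∀ {x b} C → Maybe.All (_⊆ C) (restrictClause x b C)
restrictClause-⊆ [] = just []
restrictClause-⊆ {x} {b} (l ∷ C) with var l ≟ x | evalLit (λ _ → b) l
... | yes _ | true  = nothing
... | yes _ | false = Maybe.map (l ∷ʳ_) (restrictClause-⊆ C)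
... | no  _ | _ with restrictClause x b C | restrictClause-⊆ {x} {b} C
...   | nothing | _        = nothing
...   | just _  | just D⊆C = just (refl ∷ D⊆C)

restrictClause-head-⊆ : ∀ {b} l C → Maybe.All (_⊆ C) (restrictClause (var l) b (l ∷ C))
restrictClause-head-⊆ {b} l C with var l ≟ var l | evalLit (λ _ → b) l
... | no  l∉l | _     = ⊥-elim (l∉l refl)
... | yes _   | true  = nothing
... | yes _   | false = restrictClause-⊆ C

Unique-resp-⊆ : ∀ {A : Set} {xs ys : List A} → xs ⊆ ys → Unique ys → Unique xs
Unique-resp-⊆ []           []      = []
Unique-resp-⊆ (_ ∷ʳ xs⊆ys) (_ ∷ u) = Unique-resp-⊆ xs⊆ys u
Unique-resp-⊆ (refl ∷ xs⊆ys) (y∉ys ∷ u) = All-resp-⊆ xs⊆ys y∉ys ∷ Unique-resp-⊆ xs⊆ys u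

restrict-unique : ∀ {x b} F → All Unique F → All Unique (restrict x b F)
restrict-unique F u = All.mapMaybe⁺ (All.map⁺ (All.map restricted-unique u))
  where
  restricted-unique : ∀ {x b C} → Unique C → Maybe.All Unique (restrictClause x b C)
  restricted-unique {C = C} uC = Maybe.map (λ D⊆C → Unique-resp-⊆ D⊆C uC) (restrictClause-⊆ C)

size : CNF → ℕ
size F = sum (map length F)

sizeᴹ : Maybe Clause → ℕ
sizeᴹ = maybe length 0

sizeᴹ-⊆ : ∀ {C m} → Maybe.All (_⊆ C) m → sizeᴹ m ℕ.≤ length C
sizeᴹ-⊆ (just D⊆C) = length-mono-≤ D⊆C
sizeᴹ-⊆ nothing    = z≤n

size-mapMaybe-∷ : ∀ (f : Clause → Maybe Clause) C F →
                  size (mapMaybe f (C ∷ F)) ≡ sizeᴹ (f C) ℕ.+ size (mapMaybe f F)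
size-mapMaybe-∷ f C F with f C
... | nothing = refl
... | just _  = refl

size-restrict-≤ : ∀ {x b} F → size (restrict x b F) ℕ.≤ size F
size-restrict-≤ [] = z≤n
size-restrict-≤ {x} {b} (C ∷ F) rewrite size-mapMaybe-∷ (restrictClause x b) C F =
  ℕ.+-mono-≤ (sizeᴹ-⊆ (restrictClause-⊆ C)) (size-restrict-≤ F)

size-restrict-head : ∀ {b} l C F → size (restrict (var l) b ((l ∷ C) ∷ F)) ℕ.≤ length C ℕ.+ size F
size-restrict-head {b} l C F rewrite size-mapMaybe-∷ (restrictClause (var l) b) (l ∷ C) F =
  ℕ.+-mono-≤ (sizeᴹ-⊆ (restrictClause-head-⊆ l C)) (size-restrict-≤ F)

ℕtoℚ-mkℚ : ∀ n → ℕtoℚ n ≡ mkℚ (ℤ.+ n) 0 (Coprime.sym (Coprime.1-coprimeTo n))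
ℕtoℚ-mkℚ n = normalize-coprime (Coprime.sym (Coprime.1-coprimeTo n))

ℕtoℚ-+ : ∀ m n → ℕtoℚ (m ℕ.+ n) ≡ ℕtoℚ m + ℕtoℚ n
ℕtoℚ-+ m n = begin-equality
  ℕtoℚ (m ℕ.+ n)
    ≡⟨ cong (_/ 1) (cong₂ ℤ._+_ (ℤ.*-identityʳ (ℤ.+ m)) (ℤ.*-identityʳ (ℤ.+ n))) ⟨
  (ℤ.+ m ℤ.* ℤ.+ 1 ℤ.+ ℤ.+ n ℤ.* ℤ.+ 1) / 1
    ≡⟨ cong₂ _+_ (ℕtoℚ-mkℚ m) (ℕtoℚ-mkℚ n) ⟨
  ℕtoℚ m + ℕtoℚ n ∎

ℕtoℚ-double : ∀ n a → ℕtoℚ (2 ℕ.* n) * a ≡ ℕtoℚ n * a + ℕtoℚ n * a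
ℕtoℚ-double n a = begin-equality
  ℕtoℚ (n ℕ.+ (n ℕ.+ 0)) * a ≡⟨ cong (λ k → ℕtoℚ (n ℕ.+ k) * a) (ℕ.+-identityʳ n) ⟩
  ℕtoℚ (n ℕ.+ n) * a         ≡⟨ cong (_* a) (ℕtoℚ-+ n n) ⟩
  (ℕtoℚ n + ℕtoℚ n) * a      ≡⟨ *-distribʳ-+ a (ℕtoℚ n) (ℕtoℚ n) ⟩
  ℕtoℚ n * a + ℕtoℚ n * a    ∎

double-<1⇒sum-<1 : ∀ u v → u + u < 1ℚ → v + v < 1ℚ → u + v < 1ℚ
double-<1⇒sum-<1 u v 2u<1 2v<1 with u + v <? 1ℚ
... | yes u+v<1 = u+v<1
... | no  u+v≮1 = ⊥-elim (<-irrefl refl (begin-strict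
  1ℚ + 1ℚ           ≤⟨ +-mono-≤ (≮⇒≥ u+v≮1) (≮⇒≥ u+v≮1) ⟩
  (u + v) + (u + v) ≡⟨ solve 2 (λ u v → (u :+ v) :+ (u :+ v) := (u :+ u) :+ (v :+ v)) refl u v ⟩
  (u + u) + (v + v) <⟨ +-mono-< 2u<1 2v<1 ⟩
  1ℚ + 1ℚ           ∎))

*-monoˡ-≤-0≤ : ∀ {r p q} → 0ℚ ≤ r → p ≤ q → r * p ≤ r * q
*-monoˡ-≤-0≤ {r} 0≤r = *-monoˡ-≤-nonNeg r {{nonNegative 0≤r}}

0≤* : ∀ {p q} → 0ℚ ≤ p → 0ℚ ≤ q → 0ℚ ≤ p * q
0≤* {p} {q} 0≤p 0≤q = begin
  0ℚ     ≡⟨ *-zeroʳ p ⟨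
  p * 0ℚ ≤⟨ *-monoˡ-≤-0≤ 0≤p 0≤q ⟩
  p * q  ∎

module Weights (ρ : ℚ) (0≤ρ : 0ℚ ≤ ρ) (ρ≤1 : ρ ≤ 1ℚ) where

  σ : ℚ
  σ = 1ℚ - ρ

  0≤σ : 0ℚ ≤ σ
  0≤σ = begin
    0ℚ     ≡⟨ +-inverseʳ ρ ⟨
    ρ - ρ  ≤⟨ +-monoˡ-≤ (- ρ) ρ≤1 ⟩
    σ      ∎

  average : ℚ → ℚ → ℚ
  average a c = ρ * a + σ * c

  average-1 : average 1ℚ 1ℚ ≡ 1ℚ
  average-1 = solve 1 (λ ρ → ρ :* con 1ℚ :+ (con 1ℚ :- ρ) :* con 1ℚ := con 1ℚ) refl ρ

  average-0 : average 0ℚ 0ℚ ≡ 0ℚ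
  average-0 = solve 1 (λ ρ → ρ :* con 0ℚ :+ (con 1ℚ :- ρ) :* con 0ℚ := con 0ℚ) refl ρ

  average-0ˡ : ∀ c → average 0ℚ c ≡ σ * c
  average-0ˡ = solve 2 (λ ρ c → ρ :* con 0ℚ :+ (con 1ℚ :- ρ) :* c := (con 1ℚ :- ρ) :* c) refl ρ

  average-0ʳ : ∀ a → average a 0ℚ ≡ ρ * a
  average-0ʳ = solve 2 (λ ρ a → ρ :* a :+ (con 1ℚ :- ρ) :* con 0ℚ := ρ :* a) refl ρ

  average-*ˡ : ∀ w a c → average (w * a) (w * c) ≡ w * average a c
  average-*ˡ = solve 4 (λ ρ w a c → ρ :* (w :* a) :+ (con 1ℚ :- ρ) :* (w :* c)
                                    := w :* (ρ :* a :+ (con 1ℚ :- ρ) :* c)) refl ρ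

  average-+ : ∀ a A c B → average (a + A) (c + B) ≡ average a c + average A B
  average-+ = solve 5 (λ ρ a A c B → ρ :* (a :+ A) :+ (con 1ℚ :- ρ) :* (c :+ B)
                                    := (ρ :* a :+ (con 1ℚ :- ρ) :* c) :+ (ρ :* A :+ (con 1ℚ :- ρ) :* B)) refl ρ

  average<1 : ∀ {a c} → average a c < 1ℚ → a < 1ℚ ⊎ c < 1ℚ
  average<1 {a} {c} <1 with a <? 1ℚ | c <? 1ℚ
  ... | yes a<1 | _       = inj₁ a<1
  ... | no  _   | yes c<1 = inj₂ c<1
  ... | no  a≮1 | no  c≮1 = ⊥-elim (<-irrefl refl (begin-strict
    1ℚ              ≡⟨ average-1 ⟨
    average 1ℚ 1ℚ   ≤⟨ +-mono-≤ (*-monoˡ-≤-0≤ 0≤ρ (≮⇒≥ a≮1)) (*-monoˡ-≤-0≤ 0≤σ (≮⇒≥ c≮1)) ⟩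
    average a c     <⟨ <1 ⟩
    1ℚ              ∎))

  -- the probability that the literal is false
  litWeight : Literal → ℚ
  litWeight (pos _) = σ
  litWeight (neg _) = ρ

  clauseWeight : Clause → ℚ
  clauseWeight []      = 1ℚ
  clauseWeight (l ∷ C) = litWeight l * clauseWeight C

  weightᴹ : Maybe Clause → ℚ
  weightᴹ = maybe clauseWeight 0ℚ

  weight : CNF → ℚ
  weight []      = 0ℚ
  weight (C ∷ F) = clauseWeight C + weight F

  litWeight-nonNeg : ∀ l → 0ℚ ≤ litWeight l
  litWeight-nonNeg (pos _) = 0≤σ
  litWeight-nonNeg (neg _) = 0≤ρ

  clauseWeight-nonNeg : ∀ C → 0ℚ ≤ clauseWeight C
  clauseWeight-nonNeg []      = ≤-trans 0≤ρ ρ≤1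
  clauseWeight-nonNeg (l ∷ C) = 0≤* (litWeight-nonNeg l) (clauseWeight-nonNeg C)

  weight-nonNeg : ∀ F → 0ℚ ≤ weight F
  weight-nonNeg []      = ≤-refl
  weight-nonNeg (C ∷ F) = +-mono-≤ (clauseWeight-nonNeg C) (weight-nonNeg F)

  weightᴹ-map-∷ : ∀ l m → weightᴹ (Data.Maybe.map (l ∷_) m) ≡ litWeight l * weightᴹ m
  weightᴹ-map-∷ l nothing  = sym (*-zeroʳ (litWeight l))
  weightᴹ-map-∷ l (just _) = refl

  weight-mapMaybe-∷ : ∀ (f : Clause → Maybe Clause) C F →
                      weight (mapMaybe f (C ∷ F)) ≡ weightᴹ (f C) + weight (mapMaybe f F)
  weight-mapMaybe-∷ f C F with f C
  ... | nothing = sym (+-identityˡ _)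
  ... | just _  = refl

  weight-++ : ∀ F G → weight (F ++ G) ≡ weight F + weight G
  weight-++ []      G = sym (+-identityˡ (weight G))
  weight-++ (C ∷ F) G =
    trans (cong (clauseWeight C +_) (weight-++ F G)) (sym (+-assoc (clauseWeight C) (weight F) (weight G)))

  restrictClause-weight-≤ : ∀ {x b} C → All (falsifiedBy x b ≢_) C →
                            weightᴹ (restrictClause x b C) ≤ clauseWeight C
  restrictClause-weight-≤ [] [] = ≤-refl
  restrictClause-weight-≤ {x} {b} (l ∷ C) (l≢ ∷ C≢) with var l ≟ x | evalLit (λ _ → b) l in value
  ... | yes _   | true  = clauseWeight-nonNeg (l ∷ C)
  ... | yes l∈x | false = ⊥-elim (l≢ (sym (falsified-literal l l∈x value)))
  ... | no  _   | _     = begin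
    weightᴹ (Data.Maybe.map (l ∷_) (restrictClause x b C)) ≡⟨ weightᴹ-map-∷ l (restrictClause x b C) ⟩
    litWeight l * weightᴹ (restrictClause x b C)
      ≤⟨ *-monoˡ-≤-0≤ (litWeight-nonNeg l) (restrictClause-weight-≤ C C≢) ⟩
    clauseWeight (l ∷ C) ∎

  average-map-∷ : ∀ l m m′ {W} → average (weightᴹ m) (weightᴹ m′) ≤ W →
                  average (weightᴹ (Data.Maybe.map (l ∷_) m)) (weightᴹ (Data.Maybe.map (l ∷_) m′))
                    ≤ litWeight l * W
  average-map-∷ l m m′ {W} ≤W = begin
    average (weightᴹ (Data.Maybe.map (l ∷_) m)) (weightᴹ (Data.Maybe.map (l ∷_) m′))
      ≡⟨ cong₂ average (weightᴹ-map-∷ l m) (weightᴹ-map-∷ l m′) ⟩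
    average (litWeight l * weightᴹ m) (litWeight l * weightᴹ m′)
      ≡⟨ average-*ˡ (litWeight l) (weightᴹ m) (weightᴹ m′) ⟩
    litWeight l * average (weightᴹ m) (weightᴹ m′)
      ≤⟨ *-monoˡ-≤-0≤ (litWeight-nonNeg l) ≤W ⟩
    litWeight l * W ∎

  restrictClause-average : ∀ x C → Unique C →
    average (weightᴹ (restrictClause x true C)) (weightᴹ (restrictClause x false C)) ≤ clauseWeight C
  restrictClause-average x [] [] = ≤-reflexive average-1
  restrictClause-average x (pos y ∷ C) (pos∉C ∷ uC) with y ≟ x
  ... | no  _    = average-map-∷ (pos y) (restrictClause x true C) (restrictClause x false C)
                                 (restrictClause-average x C uC)
  ... | yes refl = begin
    average 0ℚ (weightᴹ (restrictClause x false C)) ≡⟨ average-0ˡ _ ⟩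
    σ * weightᴹ (restrictClause x false C)          ≤⟨ *-monoˡ-≤-0≤ 0≤σ (restrictClause-weight-≤ C pos∉C) ⟩
    σ * clauseWeight C                              ∎
  restrictClause-average x (neg y ∷ C) (neg∉C ∷ uC) with y ≟ x
  ... | no  _    = average-map-∷ (neg y) (restrictClause x true C) (restrictClause x false C)
                                 (restrictClause-average x C uC)
  ... | yes refl = begin
    average (weightᴹ (restrictClause x true C)) 0ℚ ≡⟨ average-0ʳ _ ⟩
    ρ * weightᴹ (restrictClause x true C)          ≤⟨ *-monoˡ-≤-0≤ 0≤ρ (restrictClause-weight-≤ C neg∉C) ⟩
    ρ * clauseWeight C                             ∎

  restrict-average : ∀ x F → All Unique F →
                     average (weight (restrict x true F)) (weight (restrict x false F)) ≤ weight F
  restrict-average x [] [] = ≤-reflexive average-0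
  restrict-average x (C ∷ F) (uC ∷ uF) = begin
    average (weight (restrict x true (C ∷ F))) (weight (restrict x false (C ∷ F)))
      ≡⟨ cong₂ average (weight-mapMaybe-∷ (restrictClause x true) C F)
                       (weight-mapMaybe-∷ (restrictClause x false) C F) ⟩
    average (a + A) (c + B)
      ≡⟨ average-+ a A c B ⟩
    average a c + average A B
      ≤⟨ +-mono-≤ (restrictClause-average x C uC) (restrict-average x F uF) ⟩
    weight (C ∷ F) ∎
    where
    a = weightᴹ (restrictClause x true C)
    c = weightᴹ (restrictClause x false C)
    A = weight (restrict x true F)
    B = weight (restrict x false F)

  weight<1⇒satisfiable : ∀ F → All Unique F → weight F < 1ℚ → Satisfiable F
  weight<1⇒satisfiable F = search (size F) F ℕ.≤-refl
    where
    search : ∀ n F → size F ℕ.≤ n → All Unique F → weight F < 1ℚ → Satisfiable F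
    search _ [] _ _ _ = (λ _ → true) , []
    search _ ([] ∷ F) _ _ w<1 = ⊥-elim (<-irrefl refl (begin-strict
      1ℚ              ≡⟨ +-identityʳ 1ℚ ⟨
      1ℚ + 0ℚ         ≤⟨ +-monoʳ-≤ 1ℚ (weight-nonNeg F) ⟩
      weight ([] ∷ F) <⟨ w<1 ⟩
      1ℚ              ∎))
    search zero ((_ ∷ _) ∷ _) () _ _
    search (suc n) G@((l ∷ C) ∷ F) (s≤s size≤n) u w<1 =
      [ extend true , extend false ]′ (average<1 (≤-<-trans (restrict-average (var l) G u) w<1))
      where
      extend : ∀ b → weight (restrict (var l) b G) < 1ℚ → Satisfiable G
      extend b w′<1 with search n (restrict (var l) b G) (ℕ.≤-trans (size-restrict-head l C F) size≤n)
                                (restrict-unique G u) w′<1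
      ... | α , α⊨ = α [ var l ≔ b ] , restrict-sound G α⊨

  clauseWeight-positive : ∀ {ℓ} C → length C ≡ ℓ → All IsPos C → clauseWeight C ≡ σ ^ℚ ℓ
  clauseWeight-positive []      refl []             = refl
  clauseWeight-positive (_ ∷ C) refl (isPos _ ∷ ps) = cong (σ *_) (clauseWeight-positive C refl ps)

  clauseWeight-negative : ∀ {k} C → length C ≡ k → All IsNeg C → clauseWeight C ≡ ρ ^ℚ k
  clauseWeight-negative []      refl []             = refl
  clauseWeight-negative (_ ∷ C) refl (isNeg _ ∷ ns) = cong (ρ *_) (clauseWeight-negative C refl ns)

  weight-uniform : ∀ {a} F → All (λ C → clauseWeight C ≡ a) F → weight F ≡ ℕtoℚ (length F) * a
  weight-uniform {a} []      []          = sym (*-zeroˡ a)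
  weight-uniform {a} (C ∷ F) (C≡a ∷ F≡a) = begin-equality
    clauseWeight C + weight F    ≡⟨ cong₂ _+_ (trans C≡a (sym (*-identityˡ a))) (weight-uniform F F≡a) ⟩
    1ℚ * a + ℕtoℚ (length F) * a ≡⟨ *-distribʳ-+ a 1ℚ (ℕtoℚ (length F)) ⟨
    (1ℚ + ℕtoℚ (length F)) * a   ≡⟨ cong (_* a) (ℕtoℚ-+ 1 (length F)) ⟨
    ℕtoℚ (length (C ∷ F)) * a    ∎

lemma4 : (ℓ k : ℕ) (F⁺ F⁻ : CNF) →
         IsPositivePart ℓ F⁺ → IsNegativePart k F⁻ →
         Σ ℚ (λ ρ → 0ℚ < ρ × ρ < 1ℚ
                    × ℕtoℚ (2 Data.Nat.* ∣ F⁺ ∣) * ((1ℚ - ρ) ^ℚ ℓ) < 1ℚ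
                    × ℕtoℚ (2 Data.Nat.* ∣ F⁻ ∣) * (ρ ^ℚ k) < 1ℚ) →
         Satisfiable (F⁺ ++ F⁻)
lemma4 ℓ k F⁺ F⁻ (_ , F⁺-clauses) (_ , F⁻-clauses) (ρ , 0<ρ , ρ<1 , small⁺ , small⁻) =
  weight<1⇒satisfiable (F⁺ ++ F⁻) clauses-unique
    (subst (_< 1ℚ) (sym weight≡) (double-<1⇒sum-<1 expected⁺ expected⁻
      (subst (_< 1ℚ) (ℕtoℚ-double ∣ F⁺ ∣ (σ ^ℚ ℓ)) small⁺)
      (subst (_< 1ℚ) (ℕtoℚ-double ∣ F⁻ ∣ (ρ ^ℚ k)) small⁻)))
  where
  open Weights ρ (<⇒≤ 0<ρ) (<⇒≤ ρ<1)

  clauses-unique : All Unique (F⁺ ++ F⁻)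
  clauses-unique = All.++⁺ (All.map proj₁ F⁺-clauses) (All.map proj₁ F⁻-clauses)

  positive : ∀ {C} → PositiveClause ℓ C → clauseWeight C ≡ σ ^ℚ ℓ
  positive {C} (_ , length≡ℓ , all-pos) = clauseWeight-positive C length≡ℓ all-pos

  negative : ∀ {C} → NegativeClause k C → clauseWeight C ≡ ρ ^ℚ k
  negative {C} (_ , length≡k , all-neg) = clauseWeight-negative C length≡k all-neg

  expected⁺ expected⁻ : ℚ
  expected⁺ = ℕtoℚ ∣ F⁺ ∣ * (σ ^ℚ ℓ)
  expected⁻ = ℕtoℚ ∣ F⁻ ∣ * (ρ ^ℚ k)

  weight≡ : weight (F⁺ ++ F⁻) ≡ expected⁺ + expected⁻
  weight≡ = trans (weight-++ F⁺ F⁻) (cong₂ _+_ (weight-uniform F⁺ (All.map positive F⁺-clauses))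
                                               (weight-uniform F⁻ (All.map negative F⁻-clauses)))
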